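{- Let $G$ be a complete multipartite graph having exactly $k$ parts of odd cardinality. Then the cordial edge deficiency of $G$ is $$\mathrm{ced}(G)=\max\left\{0,\left\lfloor \tfrac{k}{2}\right\rfloor-1\right\}.$$
   Context: Graphs are finite and may have multiple edges but no loops. A binary labeling of a graph $G$ is a map $f:V(G)\to\{0,1\}$. Two real numbers $x,y$ are roughly equal if $|x-y|\le 1$. A binary labeling $f$ is friendly if $|f^{ -1}(0)|$ and $|f^{ -1}(1)|$ are roughly equal. A binary labeling $f$ induces an edge labeling $f_e:E(G)\to\{0,1\}$ by $f_e(uv)=f(u)+f(v) \pmod 2$. A friendly labeling $f$ is cordial if $|f_e^{ -1}(0)|$ and $|f_e^{ -1}(1)|$ are roughly equal; a graph is cordial if it has a cordial labeling. The cordial edge deficiency $\mathrm{ced}(G)$ is the minimum, taken over all friendly labelings $f$ of $G$, of the number of edges that must be added to $G$ (between pairs of existing distinct vertices, multiple edges allowed) so that $f$ becomes a cordial labeling of the augmented graph. A complete multipartite graph is a graph whose vertex set is partitioned into nonempty parts, with two vertices adjacent (by a single edge) if and only if they lie in different parts. -}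

module Defs where

open import Data.Nat using (ℕ; _≤_; _∸_; _%_; _/_; _⊔_)
open import Data.Nat.Properties using (_≟_)
open import Data.Bool using (Bool; true; false; not; _xor_)
open import Data.Fin using (Fin; _<?_)
import Data.Fin.Properties as FinP
open import Data.List using (List; length; filter; allFin; cartesianProduct; _++_)
open import Data.List.Relation.Unary.All using (All)
open import Data.Product using (Σ; _×_; _,_; proj₁; proj₂; ∃)
open import Relation.Binary.PropositionalEquality using (_≡_; _≢_)
open import Relation.Nullary using (¬?; Dec)
open import Relation.Nullary.Decidable using (_×-dec_)

RoughlyEqual : ℕ → ℕ → Set
RoughlyEqual x y = (x ∸ y ≤ 1) × (y ∸ x ≤ 1)

-- A finite multigraph on vertex set Fin n is given by its list of edges
-- (a list, so multiple edges are allowed); edges are unordered, stored as pairs.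
Edges : ℕ → Set
Edges n = List (Fin n × Fin n)

Loopless : ∀ {n} → Edges n → Set
Loopless E = All (λ e → proj₁ e ≢ proj₂ e) E

-- binary labeling f : V → {0,1}, with 0 = false and 1 = true
Labeling : ℕ → Set
Labeling n = Fin n → Bool

vcount : ∀ {n} → Labeling n → Bool → ℕ
vcount {n} f b = length (filter (λ v → f v Data.Bool.≟ b) (allFin n))

edgeLabel : ∀ {n} → Labeling n → Fin n × Fin n → Bool
edgeLabel f (u , v) = f u xor f v

ecount : ∀ {n} → Labeling n → Edges n → Bool → ℕ
ecount f E b = length (filter (λ e → edgeLabel f e Data.Bool.≟ b) E)

Friendly : ∀ {n} → Labeling n → Set
Friendly f = RoughlyEqual (vcount f false) (vcount f true)

Cordial : ∀ {n} → Edges n → Labeling n → Set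
Cordial E f = Friendly f × RoughlyEqual (ecount f E false) (ecount f E true)

Augments : ∀ {n} → Edges n → Labeling n → Edges n → Set
Augments E f L = Loopless L × Cordial (E ++ L) f

-- ced(G) = c : c is the minimum, over friendly labelings f, of the least number
-- of added edges making f cordial.
IsCED : ∀ {n} → Edges n → ℕ → Set
IsCED {n} E c =
  (Σ (Labeling n) λ f → Friendly f × Σ (Edges n) λ L → Augments E f L × length L ≡ c)
  × (∀ (f : Labeling n) → Friendly f → ∀ (L : Edges n) → Augments E f L → c ≤ length L)

-- Complete multipartite graph on Fin n with parts indexed by Fin r, given by the
-- part map p : Fin n → Fin r (all parts required nonempty separately).
cmpEdges : ∀ {n r} → (Fin n → Fin r) → Edges n
cmpEdges {n} p =
  filter (λ e → (proj₁ e <? proj₂ e) ×-dec ¬? (FinP._≟_ (p (proj₁ e)) (p (proj₂ e))))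
         (cartesianProduct (allFin n) (allFin n))

PartsNonempty : ∀ {n r} → (Fin n → Fin r) → Set
PartsNonempty {n} {r} p = ∀ (i : Fin r) → ∃ λ (v : Fin n) → p v ≡ i

partSize : ∀ {n r} → (Fin n → Fin r) → Fin r → ℕ
partSize {n} p i = length (filter (λ v → FinP._≟_ (p v) i) (allFin n))

oddParts : ∀ {n r} → (Fin n → Fin r) → ℕ
oddParts {n} {r} p = length (filter (λ i → partSize p i % 2 ≟ 1) (allFin r))

module Submission where

-- Encode a labeling by signs σ v = ±1 (label 0 ↦ 1, label 1 ↦ -1), and let D = Σ_v σ v and
-- d_i = Σ_{v in part i} σ v.  An edge uv has label 1 exactly when σ u σ v = -1, so in a complete
-- multipartite graph with e_b edges of label b,
--   2 (e₁ - e₀) = Σ_i d_i² - D².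
-- Friendliness means D² ≤ 1, and d_i is odd for each of the k odd parts, so 2 (e₁ - e₀) ≥ k - 1;
-- since every added edge raises e₀ or e₁ by one, cordiality needs at least ⌊k/2⌋ - 1 new edges.
-- Conversely, balancing every part up to one vertex and letting the surplus signs of the odd parts
-- alternate gives D ∈ {0, 1} and Σ_i d_i² = k, hence e₁ = e₀ + ⌊k/2⌋; then ⌊k/2⌋ - 1 parallel
-- copies of an edge between two equally labeled vertices (among any three vertices from distinct
-- parts two share a label) make the labeling cordial.

open import Defs
open import Data.Bool as Bool using (Bool; true; false; not; _xor_; if_then_else_)
open import Data.Bool.Properties using (xor-same)
open import Data.Empty using (⊥-elim)
open import Data.Fin using (Fin; zero; suc; _<_; _<?_)
import Data.Fin.Properties as Fin
open import Data.Integer as ℤ using (ℤ; +_; -[1+_]; -_; _+_; _*_; _-_; _⊖_; 0ℤ; 1ℤ; -1ℤ; +≤+)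
import Data.Integer.Properties as ℤP
open import Data.Integer.Tactic.RingSolver using (solve-∀)
open import Data.List using (List; []; _∷_; length; filter; allFin; tabulate; map; replicate; _++_; cartesianProduct)
open import Data.List.Properties
  using (length-++; length-filter; filter-++; filter-all; filter-none; length-replicate; length-tabulate)
open import Data.List.Relation.Unary.All using ([])
open import Data.List.Relation.Unary.All.Properties using (replicate⁺)
open import Data.Nat as ℕ using (ℕ; zero; suc; z≤n; s≤s; _%_; _/_; _∸_; _⊔_)
open import Data.Nat.DivMod
  using (m*n%n≡0; [m+kn]%n≡m%n; m<n*o⇒m/o<n; m<n⇒m/n≡0; m/n*n≤m; m*n/n≡m; +-distrib-/-∣ˡ)
open import Data.Nat.Divisibility using (n∣m*n)
import Data.Nat.Properties as ℕP
open import Data.Nat.Tactic.RingSolver renaming (solve-∀ to ℕ-solve-∀)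
open import Data.Product using (Σ; ∃; _×_; _,_; proj₁; proj₂)
open import Data.Sum using (_⊎_; inj₁; inj₂)
import Data.Sum as Sum
import Data.Vec.Functional as Vector
open import Function using (_∘_; id)
open import Relation.Binary.PropositionalEquality
open import Relation.Nullary using (Dec; does; yes; no; ¬_; ¬?)
open import Relation.Nullary.Decidable using (_×-dec_)
open import Relation.Unary using (Decidable)

open import Algebra.Properties.Semiring.Sum ℤP.+-*-semiring
  using (sum; sum-syntax; sum-replicate-zero; sum-cong-≗; ∑-distrib-+; ∑-comm; *-distribˡ-sum)

sign : Bool → ℤ
sign false = 1ℤ
sign true = -1ℤ

𝟙 : Bool → ℤ
𝟙 b = if b then 1ℤ else 0ℤ

ZeroOr : ℤ → ℤ → Set
ZeroOr s d = d ≡ 0ℤ ⊎ d ≡ s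

sign-square : ∀ b → sign b * sign b ≡ 1ℤ
sign-square false = refl
sign-square true = refl

sign-not+sign : ∀ b → sign (not b) + sign b ≡ 0ℤ
sign-not+sign false = refl
sign-not+sign true = refl

if-*ʳ : ∀ b (x y : ℤ) → (if b then x else 0ℤ) * y ≡ (if b then x * y else 0ℤ)
if-*ʳ true x y = refl
if-*ʳ false x y = refl

if-square : ∀ b (x : ℤ) → (if b then x else 0ℤ) * (if b then x else 0ℤ) ≡ (if b then x * x else 0ℤ)
if-square true x = refl
if-square false x = refl

∑-neg : ∀ {n} (g : Fin n → ℤ) → ∑[ i < n ] (- g i) ≡ - sum g
∑-neg {zero} g = refl
∑-neg {suc n} g = begin
  - g zero + ∑[ i < n ] (- g (suc i))  ≡⟨ cong (λ s → - g zero + s) (∑-neg (g ∘ suc)) ⟩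
  - g zero - sum (g ∘ suc)             ≡⟨ ℤP.neg-distrib-+ (g zero) _ ⟨
  - sum g                              ∎
  where
  open ≡-Reasoning

∑-sub : ∀ {n} (g h : Fin n → ℤ) → ∑[ i < n ] (g i - h i) ≡ sum g - sum h
∑-sub g h = trans (∑-distrib-+ g (-_ ∘ h)) (cong (λ s → sum g + s) (∑-neg h))

∑-mono-≤ : ∀ {n} {g h : Fin n → ℤ} → (∀ i → g i ℤ.≤ h i) → sum g ℤ.≤ sum h
∑-mono-≤ {zero} g≤h = ℤP.≤-refl
∑-mono-≤ {suc n} g≤h = ℤP.+-mono-≤ (g≤h zero) (∑-mono-≤ (g≤h ∘ suc))

∑-select : ∀ {r} (j : Fin r) (g : Fin r → ℤ) → ∑[ i < r ] (if does (j Fin.≟ i) then g i else 0ℤ) ≡ g j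
∑-select {suc r} zero g = trans (cong (λ s → g zero + s) (sum-replicate-zero r)) (ℤP.+-identityʳ _)
∑-select {suc r} (suc j) g = trans (ℤP.+-identityˡ _) (∑-select j (g ∘ suc))

listSum : ∀ {a} {A : Set a} → (A → ℤ) → List A → ℤ
listSum g [] = 0ℤ
listSum g (x ∷ xs) = g x + listSum g xs

listSum-++ : ∀ {a} {A : Set a} (g : A → ℤ) (xs ys : List A) → listSum g (xs ++ ys) ≡ listSum g xs + listSum g ys
listSum-++ g [] ys = sym (ℤP.+-identityˡ _)
listSum-++ g (x ∷ xs) ys = trans (cong (λ s → g x + s) (listSum-++ g xs ys)) (sym (ℤP.+-assoc (g x) _ _))

listSum-map : ∀ {a b} {A : Set a} {B : Set b} (g : B → ℤ) (h : A → B) (xs : List A) →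
  listSum g (map h xs) ≡ listSum (g ∘ h) xs
listSum-map g h [] = refl
listSum-map g h (x ∷ xs) = cong (λ s → g (h x) + s) (listSum-map g h xs)

listSum-tabulate : ∀ {a} {A : Set a} {n} (g : A → ℤ) (h : Fin n → A) → listSum g (tabulate h) ≡ ∑[ i < n ] g (h i)
listSum-tabulate {n = zero} g h = refl
listSum-tabulate {n = suc n} g h = cong (λ s → g (h zero) + s) (listSum-tabulate g (h ∘ suc))

listSum-filter : ∀ {a p} {A : Set a} {P : A → Set p} (g : A → ℤ) (P? : Decidable P) (xs : List A) →
  listSum g (filter P? xs) ≡ listSum (λ x → if does (P? x) then g x else 0ℤ) xs
listSum-filter g P? [] = refl
listSum-filter g P? (x ∷ xs) with does (P? x)
... | true = cong (λ s → g x + s) (listSum-filter g P? xs)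
... | false = trans (listSum-filter g P? xs) (sym (ℤP.+-identityˡ _))

listSum-cartesianProduct : ∀ {a b} {A : Set a} {B : Set b} (g : A × B → ℤ) (xs : List A) (ys : List B) →
  listSum g (cartesianProduct xs ys) ≡ listSum (λ x → listSum (λ y → g (x , y)) ys) xs
listSum-cartesianProduct g [] ys = refl
listSum-cartesianProduct g (x ∷ xs) ys = begin
  listSum g (map (x ,_) ys ++ cartesianProduct xs ys)
    ≡⟨ listSum-++ g (map (x ,_) ys) _ ⟩
  listSum g (map (x ,_) ys) + listSum g (cartesianProduct xs ys)
    ≡⟨ cong₂ _+_ (listSum-map g (x ,_) ys) (listSum-cartesianProduct g xs ys) ⟩
  listSum (λ y → g (x , y)) ys + listSum (λ x → listSum (λ y → g (x , y)) ys) xs ∎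
  where
  open ≡-Reasoning

length-filter-allFin : ∀ {n p} {P : Fin n → Set p} (P? : Decidable P) →
  + length (filter P? (allFin n)) ≡ ∑[ i < n ] 𝟙 (does (P? i))
length-filter-allFin P? = begin
  + length (filter P? (allFin _))          ≡⟨ length≡listSum (filter P? (allFin _)) ⟩
  listSum (λ _ → 1ℤ) (filter P? (allFin _)) ≡⟨ listSum-filter (λ _ → 1ℤ) P? (allFin _) ⟩
  listSum (𝟙 ∘ does ∘ P?) (allFin _)       ≡⟨ listSum-tabulate (𝟙 ∘ does ∘ P?) id ⟩
  ∑[ i < _ ] 𝟙 (does (P? i))               ∎
  where
  open ≡-Reasoning
  length≡listSum : ∀ {a} {A : Set a} (xs : List A) → + length xs ≡ listSum (λ _ → 1ℤ) xs
  length≡listSum [] = refl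
  length≡listSum (x ∷ xs) = cong (λ s → 1ℤ + s) (length≡listSum xs)

edgeProductSum : ∀ {n r} → (Fin n → Fin r) → (Fin n → ℤ) → ℤ
edgeProductSum {n} p x = ∑[ u < n ] ∑[ v < n ] (if does ((u <? v) ×-dec ¬? (p u Fin.≟ p v)) then x u * x v else 0ℤ)

partSum : ∀ {n r} → (Fin n → Fin r) → (Fin n → ℤ) → Fin r → ℤ
partSum {n} p x i = ∑[ v < n ] (if does (p v Fin.≟ i) then x v else 0ℤ)

partSquareSum : ∀ {n r} → (Fin n → Fin r) → (Fin n → ℤ) → ℤ
partSquareSum {r = r} p x = ∑[ i < r ] (partSum p x i * partSum p x i)

edgeProductSum-suc : ∀ {n r} (p : Fin (suc n) → Fin r) (x : Fin (suc n) → ℤ) →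
  edgeProductSum p x
    ≡ x zero * (sum (x ∘ suc) - partSum (p ∘ suc) (x ∘ suc) (p zero)) + edgeProductSum (p ∘ suc) (x ∘ suc)
edgeProductSum-suc {n} p x = cong₂ _+_
  (begin
    0ℤ + ∑[ v < n ] (if not (does (p zero Fin.≟ p (suc v))) then x zero * x (suc v) else 0ℤ)
      ≡⟨ ℤP.+-identityˡ _ ⟩
    ∑[ v < n ] (if not (does (p zero Fin.≟ p (suc v))) then x zero * x (suc v) else 0ℤ)
      ≡⟨ sum-cong-≗ (λ v → outside-part (p zero) (p (suc v)) (x (suc v))) ⟩
    ∑[ v < n ] (x zero * (x (suc v) - (if does (p (suc v) Fin.≟ p zero) then x (suc v) else 0ℤ)))
      ≡⟨ *-distribˡ-sum {n} (x zero) _ ⟨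
    x zero * ∑[ v < n ] (x (suc v) - (if does (p (suc v) Fin.≟ p zero) then x (suc v) else 0ℤ))
      ≡⟨ cong (x zero *_) (∑-sub {n} (x ∘ suc) _) ⟩
    x zero * (sum (x ∘ suc) - partSum (p ∘ suc) (x ∘ suc) (p zero)) ∎)
  (sum-cong-≗ {n} (λ u → ℤP.+-identityˡ _))
  where
  open ≡-Reasoning
  outside-part : ∀ {r} (a b : Fin r) y →
    (if not (does (a Fin.≟ b)) then x zero * y else 0ℤ) ≡ x zero * (y - (if does (b Fin.≟ a) then y else 0ℤ))
  outside-part a b y with a Fin.≟ b | b Fin.≟ a
  ... | yes _ | yes _ = sym (trans (cong (x zero *_) (ℤP.+-inverseʳ y)) (ℤP.*-zeroʳ (x zero)))
  ... | no _ | no _ = cong (x zero *_) (sym (ℤP.+-identityʳ y))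
  ... | yes a≡b | no b≢a = ⊥-elim (b≢a (sym a≡b))
  ... | no a≢b | yes b≡a = ⊥-elim (a≢b (sym b≡a))

partSquareSum-suc : ∀ {n r} (p : Fin (suc n) → Fin r) (x : Fin (suc n) → ℤ) →
  partSquareSum p x
    ≡ x zero * x zero + + 2 * (x zero * partSum (p ∘ suc) (x ∘ suc) (p zero)) + partSquareSum (p ∘ suc) (x ∘ suc)
partSquareSum-suc {n} {r} p x = begin
  ∑[ i < r ] ((a i + e i) * (a i + e i))
    ≡⟨ sum-cong-≗ (λ i → square-expand (a i) (e i)) ⟩
  ∑[ i < r ] ((a i * a i + + 2 * (a i * e i)) + e i * e i)
    ≡⟨ ∑-distrib-+ {r} _ _ ⟩
  ∑[ i < r ] (a i * a i + + 2 * (a i * e i)) + ∑[ i < r ] (e i * e i)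
    ≡⟨ cong (_+ ∑[ i < r ] (e i * e i)) (∑-distrib-+ {r} _ _) ⟩
  ∑[ i < r ] (a i * a i) + ∑[ i < r ] (+ 2 * (a i * e i)) + ∑[ i < r ] (e i * e i)
    ≡⟨ cong (λ s → s + ∑[ i < r ] (e i * e i)) (cong₂ _+_ a²-sum ae-sum) ⟩
  x zero * x zero + + 2 * (x zero * e (p zero)) + ∑[ i < r ] (e i * e i) ∎
  where
  open ≡-Reasoning
  a e : Fin r → ℤ
  a i = if does (p zero Fin.≟ i) then x zero else 0ℤ
  e = partSum (p ∘ suc) (x ∘ suc)
  square-expand : ∀ a e → (a + e) * (a + e) ≡ (a * a + + 2 * (a * e)) + e * e
  square-expand = solve-∀
  a²-sum : ∑[ i < r ] (a i * a i) ≡ x zero * x zero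
  a²-sum = trans (sum-cong-≗ (λ i → if-square (does (p zero Fin.≟ i)) (x zero)))
    (∑-select (p zero) (λ _ → x zero * x zero))
  ae-sum : ∑[ i < r ] (+ 2 * (a i * e i)) ≡ + 2 * (x zero * e (p zero))
  ae-sum = trans (sym (*-distribˡ-sum {r} (+ 2) _))
    (cong (+ 2 *_) (trans (sum-cong-≗ {r} (λ i → if-*ʳ (does (p zero Fin.≟ i)) (x zero) (e i)))
      (∑-select (p zero) (λ i → x zero * e i))))

twice-edgeProductSum : ∀ {n r} (p : Fin n → Fin r) (x : Fin n → ℤ) →
  + 2 * edgeProductSum p x ≡ sum x * sum x - partSquareSum p x
twice-edgeProductSum {zero} {r} p x = sym (cong (_-_ 0ℤ) (sum-replicate-zero r))
twice-edgeProductSum {suc n} {r} p x = begin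
  + 2 * edgeProductSum p x
    ≡⟨ cong (+ 2 *_) (edgeProductSum-suc p x) ⟩
  + 2 * (x₀ * (S - d) + edgeProductSum (p ∘ suc) (x ∘ suc))
    ≡⟨ ℤP.*-distribˡ-+ (+ 2) (x₀ * (S - d)) _ ⟩
  + 2 * (x₀ * (S - d)) + + 2 * edgeProductSum (p ∘ suc) (x ∘ suc)
    ≡⟨ cong (λ c → + 2 * (x₀ * (S - d)) + c) (twice-edgeProductSum (p ∘ suc) (x ∘ suc)) ⟩
  + 2 * (x₀ * (S - d)) + (S * S - Q)
    ≡⟨ prepend-vertex x₀ S d Q ⟩
  (x₀ + S) * (x₀ + S) - (x₀ * x₀ + + 2 * (x₀ * d) + Q)
    ≡⟨ cong (_-_ ((x₀ + S) * (x₀ + S))) (partSquareSum-suc p x) ⟨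
  sum x * sum x - partSquareSum p x ∎
  where
  open ≡-Reasoning
  x₀ = x zero
  S = sum (x ∘ suc)
  d = partSum (p ∘ suc) (x ∘ suc) (p zero)
  Q = partSquareSum (p ∘ suc) (x ∘ suc)
  prepend-vertex : ∀ x₀ S d Q →
    + 2 * (x₀ * (S - d)) + (S * S - Q) ≡ (x₀ + S) * (x₀ + S) - (x₀ * x₀ + + 2 * (x₀ * d) + Q)
  prepend-vertex = solve-∀

∑-partSum : ∀ {n r} (p : Fin n → Fin r) (x : Fin n → ℤ) → ∑[ i < r ] partSum p x i ≡ sum x
∑-partSum {n} {r} p x = trans (∑-comm {r} {n} (λ i v → if does (p v Fin.≟ i) then x v else 0ℤ))
  (sum-cong-≗ {n} (λ v → ∑-select (p v) (λ _ → x v)))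

edgeSign : ∀ {n} → Labeling n → Fin n × Fin n → ℤ
edgeSign f (u , v) = - (sign (f u) * sign (f v))

ecount-true-false : ∀ {n} (f : Labeling n) (E : Edges n) →
  + ecount f E true - + ecount f E false ≡ listSum (edgeSign f) E
ecount-true-false f [] = refl
ecount-true-false f (e ∷ E) = trans (cons-step e) (cong (λ s → edgeSign f e + s) (ecount-true-false f E))
  where
  trues = + ecount f E true
  falses = + ecount f E false
  one-more-true : ∀ t e → (1ℤ + t) - e ≡ 1ℤ + (t - e)
  one-more-true = solve-∀
  one-more-false : ∀ t e → t - (1ℤ + e) ≡ -1ℤ + (t - e)
  one-more-false = solve-∀
  cons-step : ∀ e → + ecount f (e ∷ E) true - + ecount f (e ∷ E) false ≡ edgeSign f e + (trues - falses)
  cons-step (u , v) with f u | f v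
  ... | true | true = one-more-false trues falses
  ... | true | false = one-more-true trues falses
  ... | false | true = one-more-true trues falses
  ... | false | false = one-more-false trues falses

ecount-cmpEdges : ∀ {n r} (p : Fin n → Fin r) (f : Labeling n) →
  + ecount f (cmpEdges p) true - + ecount f (cmpEdges p) false ≡ - edgeProductSum p (sign ∘ f)
ecount-cmpEdges {n} p f = begin
  + ecount f (cmpEdges p) true - + ecount f (cmpEdges p) false
    ≡⟨ ecount-true-false f (cmpEdges p) ⟩
  listSum (edgeSign f) (cmpEdges p)
    ≡⟨ listSum-filter (edgeSign f) different-parts (cartesianProduct (allFin n) (allFin n)) ⟩
  listSum g (cartesianProduct (allFin n) (allFin n))
    ≡⟨ listSum-cartesianProduct g (allFin n) (allFin n) ⟩
  listSum (λ u → listSum (λ v → g (u , v)) (allFin n)) (allFin n)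
    ≡⟨ listSum-tabulate {n = n} (λ u → listSum (λ v → g (u , v)) (allFin n)) id ⟩
  ∑[ u < n ] listSum (λ v → g (u , v)) (allFin n)
    ≡⟨ sum-cong-≗ {n} (λ u → listSum-tabulate {n = n} (λ v → g (u , v)) id) ⟩
  ∑[ u < n ] ∑[ v < n ] g (u , v)
    ≡⟨ sum-cong-≗ {n} (λ u →
         trans (sum-cong-≗ {n} (λ v → if-neg (does (different-parts (u , v))) _)) (∑-neg {n} _)) ⟩
  ∑[ u < n ] (- ∑[ v < n ] (if does (different-parts (u , v)) then sign (f u) * sign (f v) else 0ℤ))
    ≡⟨ ∑-neg {n} _ ⟩
  - edgeProductSum p (sign ∘ f) ∎
  where
  open ≡-Reasoning
  different-parts : Decidable (λ (e : Fin n × Fin n) → proj₁ e < proj₂ e × ¬ p (proj₁ e) ≡ p (proj₂ e))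
  different-parts (u , v) = (u <? v) ×-dec ¬? (p u Fin.≟ p v)
  g : Fin n × Fin n → ℤ
  g e = if does (different-parts e) then edgeSign f e else 0ℤ
  if-neg : ∀ b x → (if b then - x else 0ℤ) ≡ - (if b then x else 0ℤ)
  if-neg true x = refl
  if-neg false x = refl

twice-ecount-gap : ∀ {n r} (p : Fin n → Fin r) (f : Labeling n) →
  + 2 * (+ ecount f (cmpEdges p) true - + ecount f (cmpEdges p) false)
    ≡ partSquareSum p (sign ∘ f) - sum (sign ∘ f) * sum (sign ∘ f)
twice-ecount-gap p f = begin
  + 2 * (+ ecount f (cmpEdges p) true - + ecount f (cmpEdges p) false)
    ≡⟨ cong (+ 2 *_) (ecount-cmpEdges p f) ⟩
  + 2 * - edgeProductSum p (sign ∘ f)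
    ≡⟨ ℤP.neg-distribʳ-* (+ 2) (edgeProductSum p (sign ∘ f)) ⟨
  - (+ 2 * edgeProductSum p (sign ∘ f))
    ≡⟨ cong -_ (twice-edgeProductSum p (sign ∘ f)) ⟩
  - (D * D - partSquareSum p (sign ∘ f))
    ≡⟨ neg-sub (D * D) (partSquareSum p (sign ∘ f)) ⟩
  partSquareSum p (sign ∘ f) - D * D ∎
  where
  open ≡-Reasoning
  D = sum (sign ∘ f)
  neg-sub : ∀ a b → - (a - b) ≡ b - a
  neg-sub = solve-∀

ecount-++ : ∀ {n} (f : Labeling n) (E L : Edges n) b → ecount f (E ++ L) b ≡ ecount f E b ℕ.+ ecount f L b
ecount-++ f E L b = trans (cong length (filter-++ (λ e → edgeLabel f e Bool.≟ b) E L)) (length-++ (filter _ E))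

vcount-false⊖true : ∀ {n} (f : Labeling n) → vcount f false ⊖ vcount f true ≡ sum (sign ∘ f)
vcount-false⊖true {n} f = begin
  vcount f false ⊖ vcount f true
    ≡⟨ ℤP.m-n≡m⊖n (vcount f false) (vcount f true) ⟨
  + vcount f false - + vcount f true
    ≡⟨ cong₂ _-_ (length-filter-allFin (λ v → f v Bool.≟ false))
                 (length-filter-allFin (λ v → f v Bool.≟ true)) ⟩
  ∑[ v < n ] 𝟙 (does (f v Bool.≟ false)) - ∑[ v < n ] 𝟙 (does (f v Bool.≟ true))
    ≡⟨ ∑-sub {n} _ _ ⟨
  ∑[ v < n ] (𝟙 (does (f v Bool.≟ false)) - 𝟙 (does (f v Bool.≟ true)))
    ≡⟨ sum-cong-≗ {n} (λ v → indicators-sign (f v)) ⟩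
  sum (sign ∘ f) ∎
  where
  open ≡-Reasoning
  indicators-sign : ∀ b → 𝟙 (does (b Bool.≟ false)) - 𝟙 (does (b Bool.≟ true)) ≡ sign b
  indicators-sign false = refl
  indicators-sign true = refl

roughlyEqual⇒⊖² : ∀ x y → RoughlyEqual x y → (x ⊖ y) * (x ⊖ y) ℤ.≤ 1ℤ
roughlyEqual⇒⊖² zero zero _ = +≤+ z≤n
roughlyEqual⇒⊖² zero (suc zero) _ = +≤+ (s≤s z≤n)
roughlyEqual⇒⊖² (suc zero) zero _ = +≤+ (s≤s z≤n)
roughlyEqual⇒⊖² zero (suc (suc y)) (_ , s≤s ())
roughlyEqual⇒⊖² (suc (suc x)) zero (s≤s () , _)
roughlyEqual⇒⊖² (suc x) (suc y) x≈y rewrite ℤP.[1+m]⊖[1+n]≡m⊖n x y = roughlyEqual⇒⊖² x y x≈y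

⊖-bit⇒roughlyEqual : ∀ x y → ZeroOr 1ℤ (x ⊖ y) → RoughlyEqual x y
⊖-bit⇒roughlyEqual zero zero _ = z≤n , z≤n
⊖-bit⇒roughlyEqual (suc zero) zero _ = s≤s z≤n , z≤n
⊖-bit⇒roughlyEqual zero (suc y) (inj₁ ())
⊖-bit⇒roughlyEqual zero (suc y) (inj₂ ())
⊖-bit⇒roughlyEqual (suc (suc x)) zero (inj₁ ())
⊖-bit⇒roughlyEqual (suc (suc x)) zero (inj₂ ())
⊖-bit⇒roughlyEqual (suc x) (suc y) bit rewrite ℤP.[1+m]⊖[1+n]≡m⊖n x y = ⊖-bit⇒roughlyEqual x y bit

friendly⇒sum²≤1 : ∀ {n} (f : Labeling n) → Friendly f → sum (sign ∘ f) * sum (sign ∘ f) ℤ.≤ 1ℤ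
friendly⇒sum²≤1 f friendly =
  subst (λ D → D * D ℤ.≤ 1ℤ) (vcount-false⊖true f) (roughlyEqual⇒⊖² (vcount f false) (vcount f true) friendly)

oddPart : ∀ {n r} → (Fin n → Fin r) → Fin r → Bool
oddPart p i = does (partSize p i % 2 ℕ.≟ 1)

trueInPart : ∀ {n r} → (Fin n → Fin r) → Labeling n → Fin r → ℕ
trueInPart {n} p f i = length (filter (λ v → (p v Fin.≟ i) ×-dec (f v Bool.≟ true)) (allFin n))

partSize≡partSum+2*trueInPart : ∀ {n r} (p : Fin n → Fin r) (f : Labeling n) i →
  + partSize p i ≡ partSum p (sign ∘ f) i + + (2 ℕ.* trueInPart p f i)
partSize≡partSum+2*trueInPart {n} p f i = begin
  + partSize p i
    ≡⟨ length-filter-allFin (λ v → p v Fin.≟ i) ⟩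
  ∑[ v < n ] 𝟙 (in-part v)
    ≡⟨ sum-cong-≗ {n} (λ v → split (in-part v) (f v)) ⟩
  ∑[ v < n ] ((if in-part v then sign (f v) else 0ℤ) + + 2 * 𝟙 (in-part v Bool.∧ does (f v Bool.≟ true)))
    ≡⟨ ∑-distrib-+ {n} _ _ ⟩
  partSum p (sign ∘ f) i + ∑[ v < n ] (+ 2 * 𝟙 (in-part v Bool.∧ does (f v Bool.≟ true)))
    ≡⟨ cong (_+_ (partSum p (sign ∘ f) i)) (*-distribˡ-sum {n} (+ 2) _) ⟨
  partSum p (sign ∘ f) i + + 2 * ∑[ v < n ] 𝟙 (in-part v Bool.∧ does (f v Bool.≟ true))
    ≡⟨ cong (λ s → partSum p (sign ∘ f) i + + 2 * s)
            (length-filter-allFin (λ v → (p v Fin.≟ i) ×-dec (f v Bool.≟ true))) ⟨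
  partSum p (sign ∘ f) i + + 2 * + trueInPart p f i
    ≡⟨ cong (_+_ (partSum p (sign ∘ f) i)) (ℤP.pos-* 2 (trueInPart p f i)) ⟨
  partSum p (sign ∘ f) i + + (2 ℕ.* trueInPart p f i) ∎
  where
  open ≡-Reasoning
  in-part : Fin n → Bool
  in-part v = does (p v Fin.≟ i)
  split : ∀ c b → 𝟙 c ≡ (if c then sign b else 0ℤ) + + 2 * 𝟙 (c Bool.∧ does (b Bool.≟ true))
  split true true = refl
  split true false = refl
  split false b = refl

odd-part⇒partSum≢0 : ∀ {n r} (p : Fin n → Fin r) (f : Labeling n) i →
  partSize p i % 2 ≡ 1 → partSum p (sign ∘ f) i ≢ 0ℤ
odd-part⇒partSum≢0 p f i odd d≡0 = 0≢1 (trans (sym (even (trueInPart p f i) size≡2t)) odd)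
  where
  size≡2t : partSize p i ≡ 2 ℕ.* trueInPart p f i
  size≡2t = ℤP.+-injective (trans (partSize≡partSum+2*trueInPart p f i)
    (trans (cong (λ d → d + + (2 ℕ.* trueInPart p f i)) d≡0) (ℤP.+-identityˡ _)))
  0≢1 : 0 ≢ 1
  0≢1 ()
  even : ∀ {s} t → s ≡ 2 ℕ.* t → s % 2 ≡ 0
  even t refl = trans (cong (_% 2) (ℕP.*-comm 2 t)) (m*n%n≡0 t 2)

partSum²≡1⇒odd-part : ∀ {n r} (p : Fin n → Fin r) (f : Labeling n) i →
  partSum p (sign ∘ f) i * partSum p (sign ∘ f) i ≡ 1ℤ → partSize p i % 2 ≡ 1
partSum²≡1⇒odd-part p f i d²≡1 =
  unit+even (partSum p (sign ∘ f) i) (trueInPart p f i) d²≡1 (partSize≡partSum+2*trueInPart p f i)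
  where
  odd : ∀ {s} t → s ≡ 1 ℕ.+ t ℕ.* 2 → s % 2 ≡ 1
  odd t refl = [m+kn]%n≡m%n 1 t 2
  unit+even : ∀ d t {s} → d * d ≡ 1ℤ → + s ≡ d + + (2 ℕ.* t) → s % 2 ≡ 1
  unit+even (+ 1) t _ s≡d+2t = odd t (trans (ℤP.+-injective s≡d+2t) (cong suc (ℕP.*-comm 2 t)))
  unit+even -[1+ 0 ] zero _ ()
  unit+even -[1+ 0 ] (suc t) _ s≡d+2t = odd t (trans (ℤP.+-injective s≡d+2t) (twice-suc-pred t))
    where
    twice-suc-pred : ∀ t → t ℕ.+ suc (t ℕ.+ 0) ≡ 1 ℕ.+ t ℕ.* 2
    twice-suc-pred = ℕ-solve-∀
  unit+even (+ 0) t ()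
  unit+even (+ suc (suc m)) t ()
  unit+even -[1+ suc m ] t ()

square-nonneg : ∀ x → 0ℤ ℤ.≤ x * x
square-nonneg (+ m) = subst (0ℤ ℤ.≤_) (ℤP.pos-* m m) (+≤+ z≤n)
square-nonneg -[1+ m ] = +≤+ z≤n

nonzero⇒1≤square : ∀ x → x ≢ 0ℤ → 1ℤ ℤ.≤ x * x
nonzero⇒1≤square (+ zero) x≢0 = ⊥-elim (x≢0 refl)
nonzero⇒1≤square (+ suc m) _ = +≤+ (s≤s z≤n)
nonzero⇒1≤square -[1+ m ] _ = +≤+ (s≤s z≤n)

oddParts≤partSquareSum : ∀ {n r} (p : Fin n → Fin r) (f : Labeling n) →
  + oddParts p ℤ.≤ partSquareSum p (sign ∘ f)
oddParts≤partSquareSum {r = r} p f =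
  subst (ℤ._≤ partSquareSum p (sign ∘ f)) (sym (length-filter-allFin (λ i → partSize p i % 2 ℕ.≟ 1)))
    (∑-mono-≤ {r} bound)
  where
  bound : ∀ i → 𝟙 (oddPart p i) ℤ.≤ partSum p (sign ∘ f) i * partSum p (sign ∘ f) i
  bound i = from-parity (partSize p i % 2 ℕ.≟ 1)
    where
    from-parity : (odd? : Dec (partSize p i % 2 ≡ 1)) →
      𝟙 (does odd?) ℤ.≤ partSum p (sign ∘ f) i * partSum p (sign ∘ f) i
    from-parity (yes odd) = nonzero⇒1≤square (partSum p (sign ∘ f) i) (odd-part⇒partSum≢0 p f i odd)
    from-parity (no _) = square-nonneg (partSum p (sign ∘ f) i)

gap-lowerBound : ∀ k e₀ e₁ {Q D} → + k ℤ.≤ Q → + 2 * (+ e₁ - + e₀) ≡ Q - D * D → D * D ℤ.≤ 1ℤ →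
  2 ℕ.* e₀ ℕ.+ k ℕ.≤ 2 ℕ.* e₁ ℕ.+ 1
gap-lowerBound k e₀ e₁ {Q} {D} k≤Q gap D²≤1 = ℤP.drop‿+≤+ (begin
  + (2 ℕ.* e₀ ℕ.+ k)                      ≡⟨ trans (ℤP.pos-+ (2 ℕ.* e₀) k) (cong (_+ + k) (ℤP.pos-* 2 e₀)) ⟩
  + 2 * + e₀ + + k                        ≤⟨ ℤP.+-monoʳ-≤ (+ 2 * + e₀) k≤Q ⟩
  + 2 * + e₀ + Q                          ≡⟨ cong (_+_ (+ 2 * + e₀)) (sub-add Q (D * D)) ⟩
  + 2 * + e₀ + (Q - D * D + D * D)        ≤⟨ ℤP.+-monoʳ-≤ (+ 2 * + e₀) (ℤP.+-monoʳ-≤ (Q - D * D) D²≤1) ⟩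
  + 2 * + e₀ + (Q - D * D + 1ℤ)           ≡⟨ cong (λ g → + 2 * + e₀ + (g + 1ℤ)) gap ⟨
  + 2 * + e₀ + (+ 2 * (+ e₁ - + e₀) + 1ℤ) ≡⟨ rearrange (+ e₀) (+ e₁) ⟩
  + 2 * + e₁ + 1ℤ                         ≡⟨ cong (_+ 1ℤ) (ℤP.pos-* 2 e₁) ⟨
  + (2 ℕ.* e₁ ℕ.+ 1)                      ∎)
  where
  open ℤP.≤-Reasoning
  rearrange : ∀ a b → + 2 * a + (+ 2 * (b - a) + 1ℤ) ≡ + 2 * b + 1ℤ
  rearrange = solve-∀
  sub-add : ∀ a b → a ≡ a - b + b
  sub-add = solve-∀

deficit-lowerBound : ∀ k e₀ e₁ l →
  2 ℕ.* e₀ ℕ.+ k ℕ.≤ 2 ℕ.* e₁ ℕ.+ 1 → e₁ ℕ.≤ e₀ ℕ.+ l ℕ.+ 1 → k / 2 ∸ 1 ℕ.≤ l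
deficit-lowerBound k e₀ e₁ l gap e₁≤ = ℕP.m≤n+o⇒m∸n≤o (k / 2) 1 (ℕP.≤-pred (m<n*o⇒m/o<n k<[l+2]*2))
  where
  open ℕP.≤-Reasoning
  k≤2l+3 : k ℕ.≤ 2 ℕ.* l ℕ.+ 3
  k≤2l+3 = ℕP.+-cancelˡ-≤ (2 ℕ.* e₀) k _ (begin
    2 ℕ.* e₀ ℕ.+ k                  ≤⟨ gap ⟩
    2 ℕ.* e₁ ℕ.+ 1                  ≤⟨ ℕP.+-monoˡ-≤ 1 (ℕP.*-monoʳ-≤ 2 e₁≤) ⟩
    2 ℕ.* (e₀ ℕ.+ l ℕ.+ 1) ℕ.+ 1    ≡⟨ expand e₀ l ⟩
    2 ℕ.* e₀ ℕ.+ (2 ℕ.* l ℕ.+ 3)    ∎)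
    where
    expand : ∀ e l → 2 ℕ.* (e ℕ.+ l ℕ.+ 1) ℕ.+ 1 ≡ 2 ℕ.* e ℕ.+ (2 ℕ.* l ℕ.+ 3)
    expand = ℕ-solve-∀
  k<[l+2]*2 : k ℕ.< (2 ℕ.+ l) ℕ.* 2
  k<[l+2]*2 = ℕP.≤-trans (s≤s k≤2l+3) (ℕP.≤-reflexive (bump l))
    where
    bump : ∀ l → suc (2 ℕ.* l ℕ.+ 3) ≡ (2 ℕ.+ l) ℕ.* 2
    bump = ℕ-solve-∀

augmentation-lowerBound : ∀ {n r} (p : Fin n → Fin r) (f : Labeling n) → Friendly f →
  ∀ L → Augments (cmpEdges p) f L → oddParts p / 2 ∸ 1 ℕ.≤ length L
augmentation-lowerBound p f friendly L (_ , _ , cordial) =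
  ℕP.≤-trans (deficit-lowerBound (oddParts p) e₀ e₁ l₀ gap e₁≤)
             (length-filter (λ e → edgeLabel f e Bool.≟ false) L)
  where
  e₀ = ecount f (cmpEdges p) false
  e₁ = ecount f (cmpEdges p) true
  l₀ = ecount f L false
  l₁ = ecount f L true
  gap : 2 ℕ.* e₀ ℕ.+ oddParts p ℕ.≤ 2 ℕ.* e₁ ℕ.+ 1
  gap = gap-lowerBound (oddParts p) e₀ e₁ {D = sum (sign ∘ f)}
    (oddParts≤partSquareSum p f) (twice-ecount-gap p f) (friendly⇒sum²≤1 f friendly)
  e₁≤ : e₁ ℕ.≤ e₀ ℕ.+ l₀ ℕ.+ 1
  e₁≤ = begin
    e₁                                     ≤⟨ ℕP.m≤m+n e₁ l₁ ⟩
    e₁ ℕ.+ l₁                              ≤⟨ ℕP.m≤n+m∸n (e₁ ℕ.+ l₁) (e₀ ℕ.+ l₀) ⟩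
    e₀ ℕ.+ l₀ ℕ.+ (e₁ ℕ.+ l₁ ∸ (e₀ ℕ.+ l₀)) ≤⟨ ℕP.+-monoʳ-≤ (e₀ ℕ.+ l₀) difference≤1 ⟩
    e₀ ℕ.+ l₀ ℕ.+ 1                        ∎
    where
    open ℕP.≤-Reasoning
    difference≤1 : e₁ ℕ.+ l₁ ∸ (e₀ ℕ.+ l₀) ℕ.≤ 1
    difference≤1 = subst₂ (λ t u → t ∸ u ℕ.≤ 1) (ecount-++ f (cmpEdges p) L true) (ecount-++ f (cmpEdges p) L false)
                          (proj₂ cordial)

alternating : ∀ {r} → (Fin r → Bool) → Bool → Fin r → Bool
alternating {suc r} o b zero = b
alternating {suc r} o b (suc i) = alternating (o ∘ suc) (if o zero then not b else b) i

∑-alternating : ∀ {r} (o : Fin r → Bool) b →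
  ZeroOr (sign b) (∑[ i < r ] (if o i then sign (alternating o b i) else 0ℤ))
∑-alternating {zero} o b = inj₁ refl
∑-alternating {suc r} o b with o zero | ∑-alternating (o ∘ suc) (if o zero then not b else b)
... | true | inj₁ rest≡0 = inj₂ (trans (cong (_+_ (sign b)) rest≡0) (ℤP.+-identityʳ (sign b)))
... | true | inj₂ rest≡sign =
  inj₁ (trans (cong (_+_ (sign b)) rest≡sign) (trans (ℤP.+-comm (sign b) _) (sign-not+sign b)))
... | false | rest = Sum.map (trans (ℤP.+-identityˡ _)) (trans (ℤP.+-identityˡ _)) rest

partwise-balanced : ∀ {n r} (p : Fin n → Fin r) (τ : Fin r → Bool) →
  ∃ λ (f : Labeling n) → ∀ i → ZeroOr (sign (τ i)) (partSum p (sign ∘ f) i)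
partwise-balanced {zero} p τ = (λ ()) , λ i → inj₁ refl
partwise-balanced {suc n} p τ with partwise-balanced (p ∘ suc) τ
... | g , g-balanced = choose-first (g-balanced a)
  where
  a = p zero
  d = partSum (p ∘ suc) (sign ∘ g) a
  Balanced : Labeling (suc n) → Set
  Balanced f = ∀ i → ZeroOr (sign (τ i)) (partSum p (sign ∘ f) i)
  prepend : ∀ b → ZeroOr (sign (τ a)) (sign b + d) → Balanced (b Vector.∷ g)
  prepend b a-balanced i with a Fin.≟ i
  ... | yes refl = a-balanced
  ... | no _ = Sum.map (trans (ℤP.+-identityˡ _)) (trans (ℤP.+-identityˡ _)) (g-balanced i)
  choose-first : ZeroOr (sign (τ a)) d → ∃ Balanced
  choose-first (inj₁ d≡0) = (τ a Vector.∷ g) ,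
    prepend (τ a) (inj₂ (trans (cong (_+_ (sign (τ a))) d≡0) (ℤP.+-identityʳ _)))
  choose-first (inj₂ d≡s) = (not (τ a) Vector.∷ g) ,
    prepend (not (τ a)) (inj₁ (trans (cong (_+_ (sign (not (τ a)))) d≡s) (sign-not+sign (τ a))))

zeroOr⇒partSum≡if-oddPart : ∀ {n r} (p : Fin n → Fin r) (f : Labeling n) t i →
  ZeroOr (sign t) (partSum p (sign ∘ f) i) → partSum p (sign ∘ f) i ≡ (if oddPart p i then sign t else 0ℤ)
zeroOr⇒partSum≡if-oddPart p f t i = by-parity (partSize p i % 2 ℕ.≟ 1)
  where
  d = partSum p (sign ∘ f) i
  by-parity : (odd? : Dec (partSize p i % 2 ≡ 1)) → ZeroOr (sign t) d → d ≡ (if does odd? then sign t else 0ℤ)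
  by-parity (yes odd) (inj₁ d≡0) = ⊥-elim (odd-part⇒partSum≢0 p f i odd d≡0)
  by-parity (yes _) (inj₂ d≡s) = d≡s
  by-parity (no _) (inj₁ d≡0) = d≡0
  by-parity (no even) (inj₂ d≡s) =
    ⊥-elim (even (partSum²≡1⇒odd-part p f i (trans (cong₂ _*_ d≡s d≡s) (sign-square t))))

gap-exact : ∀ k e₀ e₁ b → b ℕ.< 2 → + 2 * (+ e₁ - + e₀) ≡ + k - + b → e₁ ≡ e₀ ℕ.+ k / 2
gap-exact k e₀ e₁ b b<2 gap = begin
  e₁                     ≡⟨ ℕP.+-identityʳ e₁ ⟨
  e₁ ℕ.+ 0               ≡⟨ cong (e₁ ℕ.+_) (m<n⇒m/n≡0 b<2) ⟨
  e₁ ℕ.+ b / 2           ≡⟨ twice-plus-half e₁ b ⟨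
  (e₁ ℕ.* 2 ℕ.+ b) / 2   ≡⟨ cong (_/ 2) balance ⟩
  (e₀ ℕ.* 2 ℕ.+ k) / 2   ≡⟨ twice-plus-half e₀ k ⟩
  e₀ ℕ.+ k / 2           ∎
  where
  open ≡-Reasoning
  twice-plus-half : ∀ m n → (m ℕ.* 2 ℕ.+ n) / 2 ≡ m ℕ.+ n / 2
  twice-plus-half m n = trans (+-distrib-/-∣ˡ n (n∣m*n m)) (cong (ℕ._+ n / 2) (m*n/n≡m m 2))
  regroup : ∀ e₀ e₁ b → e₁ * + 2 + b ≡ e₀ * + 2 + (+ 2 * (e₁ - e₀) + b)
  regroup = solve-∀
  cancel : ∀ e₀ k b → e₀ * + 2 + (k - b + b) ≡ e₀ * + 2 + k
  cancel = solve-∀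
  balance : e₁ ℕ.* 2 ℕ.+ b ≡ e₀ ℕ.* 2 ℕ.+ k
  balance = ℤP.+-injective (begin
    + (e₁ ℕ.* 2) + + b                        ≡⟨ cong (_+ + b) (ℤP.pos-* e₁ 2) ⟩
    + e₁ * + 2 + + b                          ≡⟨ regroup (+ e₀) (+ e₁) (+ b) ⟩
    + e₀ * + 2 + (+ 2 * (+ e₁ - + e₀) + + b)  ≡⟨ cong (λ g → + e₀ * + 2 + (g + + b)) gap ⟩
    + e₀ * + 2 + (+ k - + b + + b)            ≡⟨ cancel (+ e₀) (+ k) (+ b) ⟩
    + e₀ * + 2 + + k                          ≡⟨ cong (_+ + k) (ℤP.pos-* e₀ 2) ⟨
    + (e₀ ℕ.* 2) + + k                        ∎)

cordialLabeling : ∀ {n r} → (Fin n → Fin r) → Labeling n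
cordialLabeling p = proj₁ (partwise-balanced p (alternating (oddPart p) false))

module _ {n r} (p : Fin n → Fin r) where

  private
    f = cordialLabeling p
    τ = alternating (oddPart p) false

  partSum-cordialLabeling : ∀ i → partSum p (sign ∘ f) i ≡ (if oddPart p i then sign (τ i) else 0ℤ)
  partSum-cordialLabeling i = zeroOr⇒partSum≡if-oddPart p f (τ i) i (proj₂ (partwise-balanced p τ) i)

  sum-cordialLabeling : ZeroOr 1ℤ (sum (sign ∘ f))
  sum-cordialLabeling = subst (ZeroOr 1ℤ)
    (trans (sym (sum-cong-≗ {r} partSum-cordialLabeling)) (∑-partSum p (sign ∘ f))) (∑-alternating (oddPart p) false)

  partSquareSum-cordialLabeling : partSquareSum p (sign ∘ f) ≡ + oddParts p
  partSquareSum-cordialLabeling = begin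
    partSquareSum p (sign ∘ f)  ≡⟨ sum-cong-≗ {r} partSum²≡𝟙 ⟩
    ∑[ i < r ] 𝟙 (oddPart p i)  ≡⟨ length-filter-allFin (λ i → partSize p i % 2 ℕ.≟ 1) ⟨
    + oddParts p                ∎
    where
    open ≡-Reasoning
    partSum²≡𝟙 : ∀ i → partSum p (sign ∘ f) i * partSum p (sign ∘ f) i ≡ 𝟙 (oddPart p i)
    partSum²≡𝟙 i = begin
      partSum p (sign ∘ f) i * partSum p (sign ∘ f) i
        ≡⟨ cong₂ _*_ (partSum-cordialLabeling i) (partSum-cordialLabeling i) ⟩
      (if oddPart p i then sign (τ i) else 0ℤ) * (if oddPart p i then sign (τ i) else 0ℤ)
        ≡⟨ if-square (oddPart p i) (sign (τ i)) ⟩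
      (if oddPart p i then sign (τ i) * sign (τ i) else 0ℤ)
        ≡⟨ cong (λ s → if oddPart p i then s else 0ℤ) (sign-square (τ i)) ⟩
      𝟙 (oddPart p i) ∎

  cordialLabeling-friendly : Friendly f
  cordialLabeling-friendly = ⊖-bit⇒roughlyEqual (vcount f false) (vcount f true)
    (subst (ZeroOr 1ℤ) (sym (vcount-false⊖true f)) sum-cordialLabeling)

  ecount-cordialLabeling : ecount f (cmpEdges p) true ≡ ecount f (cmpEdges p) false ℕ.+ oddParts p / 2
  ecount-cordialLabeling with sum (sign ∘ f) | sum-cordialLabeling | twice-ecount-gap p f
  ... | _ | inj₁ refl | gap =
    gap-exact (oddParts p) _ _ 0 (s≤s z≤n) (trans gap (cong (_- 0ℤ) partSquareSum-cordialLabeling))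
  ... | _ | inj₂ refl | gap =
    gap-exact (oddParts p) _ _ 1 (s≤s (s≤s z≤n)) (trans gap (cong (_- 1ℤ) partSquareSum-cordialLabeling))

bool-pigeonhole : ∀ (a b c : Bool) → a ≡ b ⊎ a ≡ c ⊎ b ≡ c
bool-pigeonhole false false _ = inj₁ refl
bool-pigeonhole true true _ = inj₁ refl
bool-pigeonhole false true false = inj₂ (inj₁ refl)
bool-pigeonhole true false true = inj₂ (inj₁ refl)
bool-pigeonhole false true true = inj₂ (inj₂ refl)
bool-pigeonhole true false false = inj₂ (inj₂ refl)

sameLabelEdge : ∀ {n r} (p : Fin n → Fin r) → PartsNonempty p → 3 ℕ.≤ r → (f : Labeling n) →
  ∃ λ (e : Fin n × Fin n) → proj₁ e ≢ proj₂ e × edgeLabel f e ≡ false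
sameLabelEdge {r = 1} _ _ (s≤s ()) _
sameLabelEdge {r = 2} _ _ (s≤s (s≤s ())) _
sameLabelEdge {r = suc (suc (suc _))} p nonempty _ f = pick (bool-pigeonhole (f u) (f v) (f w))
  where
  u = proj₁ (nonempty zero)
  v = proj₁ (nonempty (suc zero))
  w = proj₁ (nonempty (suc (suc zero)))
  distinct : ∀ {x y i j} → p x ≡ i → p y ≡ j → i ≢ j → x ≢ y
  distinct px≡i py≡j i≢j x≡y = i≢j (trans (sym px≡i) (trans (cong p x≡y) py≡j))
  same-label : ∀ {x y} → f x ≡ f y → f x xor f y ≡ false
  same-label {x} fx≡fy = trans (cong (f x xor_) (sym fx≡fy)) (xor-same (f x))
  pick : f u ≡ f v ⊎ f u ≡ f w ⊎ f v ≡ f w →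
    ∃ λ (e : Fin _ × Fin _) → proj₁ e ≢ proj₂ e × edgeLabel f e ≡ false
  pick (inj₁ fu≡fv) = (u , v) , distinct (proj₂ (nonempty _)) (proj₂ (nonempty _)) (λ ()) , same-label fu≡fv
  pick (inj₂ (inj₁ fu≡fw)) = (u , w) , distinct (proj₂ (nonempty _)) (proj₂ (nonempty _)) (λ ()) , same-label fu≡fw
  pick (inj₂ (inj₂ fv≡fw)) = (v , w) , distinct (proj₂ (nonempty _)) (proj₂ (nonempty _)) (λ ()) , same-label fv≡fw

replicate-sameLabel : ∀ {n} (f : Labeling n) c (e : Fin n × Fin n) → proj₁ e ≢ proj₂ e → edgeLabel f e ≡ false →
  Loopless (replicate c e) × ecount f (replicate c e) false ≡ c × ecount f (replicate c e) true ≡ 0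
    × length (replicate c e) ≡ c
replicate-sameLabel f c e loopless label≡false =
  replicate⁺ c loopless ,
  trans (cong length (filter-all (λ e → edgeLabel f e Bool.≟ false) (replicate⁺ c label≡false))) (length-replicate c) ,
  cong length (filter-none (λ e → edgeLabel f e Bool.≟ true)
    (replicate⁺ c (λ label≡true → false≢true (trans (sym label≡false) label≡true)))) ,
  length-replicate c
  where
  false≢true : false ≢ true
  false≢true ()

positive-deficit⇒3≤parts : ∀ {n r} (p : Fin n → Fin r) → 0 ℕ.< oddParts p / 2 ∸ 1 → 3 ℕ.≤ r
positive-deficit⇒3≤parts {r = r} p positive = begin
  3                    <⟨ ℕP.n<1+n 3 ⟩
  2 ℕ.* 2              ≤⟨ ℕP.*-monoˡ-≤ 2 (ℕP.m∸n≢0⇒n<m {oddParts p / 2} (ℕP.n>0⇒n≢0 positive)) ⟩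
  oddParts p / 2 ℕ.* 2 ≤⟨ m/n*n≤m (oddParts p) 2 ⟩
  oddParts p           ≤⟨ length-filter (λ i → partSize p i % 2 ℕ.≟ 1) (allFin r) ⟩
  length (allFin r)    ≡⟨ length-tabulate id ⟩
  r                    ∎
  where open ℕP.≤-Reasoning

sameLabelEdges : ∀ {n r} (p : Fin n → Fin r) → PartsNonempty p → (f : Labeling n) →
  ∀ c → (0 ℕ.< c → 3 ℕ.≤ r) →
  Σ (Edges n) λ L → Loopless L × ecount f L false ≡ c × ecount f L true ≡ 0 × length L ≡ c
sameLabelEdges p nonempty f zero _ = [] , [] , refl , refl , refl
sameLabelEdges p nonempty f c@(suc _) 3≤r with sameLabelEdge p nonempty (3≤r (s≤s z≤n)) f
... | e , e-loopless , label≡false = replicate c e , replicate-sameLabel f c e e-loopless label≡false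

roughlyEqual-pred : ∀ a q → RoughlyEqual (a ℕ.+ (q ∸ 1)) (a ℕ.+ q)
roughlyEqual-pred a zero rewrite ℕP.n∸n≡0 (a ℕ.+ 0) = z≤n , z≤n
roughlyEqual-pred a (suc q)
  rewrite ℕP.+-suc a q | ℕP.m≤n⇒m∸n≡0 (ℕP.n≤1+n (a ℕ.+ q)) | ℕP.m+n∸n≡m 1 (a ℕ.+ q) = z≤n , ℕP.≤-refl

augmentation-upperBound : ∀ {n r} (p : Fin n → Fin r) → PartsNonempty p →
  Σ (Edges n) λ L → Augments (cmpEdges p) (cordialLabeling p) L × length L ≡ oddParts p / 2 ∸ 1
augmentation-upperBound p nonempty
  with sameLabelEdges p nonempty (cordialLabeling p) (oddParts p / 2 ∸ 1) (positive-deficit⇒3≤parts p)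
... | L , L-loopless , l₀ , l₁ , length≡ = L , (L-loopless , cordialLabeling-friendly p , cordial) , length≡
  where
  f = cordialLabeling p
  e₀ = ecount f (cmpEdges p) false
  cordial : RoughlyEqual (ecount f (cmpEdges p ++ L) false) (ecount f (cmpEdges p ++ L) true)
  cordial rewrite ecount-++ f (cmpEdges p) L false | ecount-++ f (cmpEdges p) L true | l₀ | l₁
                | ecount-cordialLabeling p | ℕP.+-identityʳ (e₀ ℕ.+ oddParts p / 2)
                = roughlyEqual-pred e₀ (oddParts p / 2)

theorem3 : ∀ (n r : ℕ) (p : Fin n → Fin r) → PartsNonempty p →
           IsCED (cmpEdges p) (0 ⊔ (oddParts p / 2 ∸ 1))
theorem3 _ _ p nonempty =
  (cordialLabeling p , cordialLabeling-friendly p , augmentation-upperBound p nonempty) , augmentation-lowerBound p
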